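{- For all positive integers $n,k$, $$\mathcal{G}\left(T_{\{2n-1\}} \stackrel{k}{\cdot - \cdot}\right)=\mathcal{G}\left(T_{\{1\}} \stackrel{k}{\cdot - \cdot}\right)=\mathcal{G}(P_{k+2})$$ and $$\mathcal{G}\left(T_{\{2n\}} \stackrel{k}{\cdot - \cdot}\right)=\mathcal{G}\left(T_{\{2\}} \stackrel{k}{\cdot - \cdot}\right).$$
   Context: Node-Kayles is the impartial game on a finite simple graph $G$ in which a move chooses a vertex $v$ and deletes its closed neighbourhood $N_G[v]$; the Grundy value is $\mathcal{G}(\emptyset)=0$, $\mathcal{G}(G)=\mathrm{mex}\{\mathcal{G}(G\setminus N_G[v]) : v\in V(G)\}$. $P_j$ denotes the path with $j$ vertices. For a positive integer $n$, $T_{\{n\}}$ is the star $K_{1,n}$ rooted at its center, and for $k\ge1$, $T_{\{n\}} \stackrel{k}{\cdot - \cdot}$ denotes the graph obtained from $T_{\{n\}}$ by identifying its root with one endpoint of a path with $k+1$ vertices (so the center receives a pendant path of $k$ additional vertices). -}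

module Defs where

open import Data.Nat using (ℕ; zero; suc; _+_; _≡ᵇ_; _≤ᵇ_; _<ᵇ_)
open import Data.Bool using (Bool; true; false; _∧_; _∨_; not; if_then_else_)
open import Data.Fin using (Fin; toℕ)
open import Data.List using (List; []; _∷_; map; length; filterᵇ)
open import Data.Bool.ListAction using (any)
open import Data.List using () renaming (allFin to allFinL)

-- A finite simple graph on the vertex set Fin n, given by a Boolean adjacency
-- relation.  Graphs built with 'fromEdges' are symmetric and loopless by construction.
record Graph (n : ℕ) : Set where
  field
    adj : Fin n → Fin n → Bool
open Graph public

fromEdges : (n : ℕ) → (ℕ → ℕ → Bool) → Graph n
fromEdges n e = record { adj = λ u v → not (toℕ u ≡ᵇ toℕ v) ∧ (e (toℕ u) (toℕ v) ∨ e (toℕ v) (toℕ u)) }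

-- mex of a finite list of naturals: least m not occurring in the list.
-- (The mex is at most the length of the list, so the search bound suffices.)
mexFrom : List ℕ → ℕ → ℕ → ℕ
mexFrom xs zero m = m
mexFrom xs (suc f) m = if any (λ x → x ≡ᵇ m) xs then mexFrom xs f (suc m) else m

mex : List ℕ → ℕ
mex xs = mexFrom xs (suc (length xs)) 0

-- Positions of Node-Kayles on G: the induced subgraph on the set S of remaining
-- vertices.  Playing v ∈ S removes the closed neighbourhood N[v].
removeClosedNbhd : ∀ {n} → Graph n → Fin n → (Fin n → Bool) → (Fin n → Bool)
removeClosedNbhd G v S w = S w ∧ not (toℕ v ≡ᵇ toℕ w) ∧ not (adj G v w)

-- Grundy value with a fuel bound; fuel ≥ |S| gives the true value since each move
-- removes at least one vertex.
grundyAux : ∀ {n} → Graph n → ℕ → (Fin n → Bool) → ℕ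
grundyAux G zero S = 0
grundyAux {n} G (suc f) S =
  mex (map (λ v → grundyAux G f (removeClosedNbhd G v S)) (filterᵇ S (allFinL n)))

grundy : ∀ {n} → Graph n → ℕ
grundy {n} G = grundyAux G n (λ _ → true)

pathGraph : (j : ℕ) → Graph j
pathGraph j = fromEdges j (λ a b → b ≡ᵇ suc a)

-- T_{m} with pendant path of k extra vertices (written T_{m} ·k-· in the paper):
-- vertex 0 is the center, 1..m are the leaves of the star K_{1,m},
-- m+1..m+k form the pendant path, attached to the center at vertex m+1.
-- Edges: {0,b} for 1 ≤ b ≤ m+1 (k ≥ 1), and {a,a+1} for m+1 ≤ a < m+k.
starPath : (m k : ℕ) → Graph (suc (m + k))
starPath m k = fromEdges (suc (m + k)) edge
  where
  edge : ℕ → ℕ → Bool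
  edge zero b = (1 ≤ᵇ b) ∧ (b ≤ᵇ suc m)
  edge (suc a) b = (m ≤ᵇ a) ∧ ((suc a) <ᵇ (m + k)) ∧ (b ≡ᵇ suc (suc a))

-- If u, w ∈ S are isolated and distinct, deleting both does not change the Grundy value: by
-- induction every other move commutes with the deletion, and playing u leaves S − u, one of
-- whose options is S − u − w, so that move has a value different from 𝒢(S − u − w).
-- If u, w, t ∈ S are pairwise false twins, deleting u and w does not change the set of option
-- values: playing u (or w) isolates the other two twins, so by the first fact it has the same
-- value as playing t in S − u − w; every other move commutes with the deletion by induction,
-- or, when it is adjacent to the twins, removes them anyway. Three leaves of the star are
-- false twins, so 𝒢(T_{m+2} ·k·) = 𝒢(T_m ·k·); finally T_{1} ·k· is the path P_{k+2}.
module Submission where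

open import Defs
open import Data.Nat using (ℕ; suc; _+_; _*_; _∸_; _≤_)
open import Data.Product using (_×_)
open import Relation.Binary.PropositionalEquality using (_≡_)

open import Algebra.Bundles using (CommutativeMonoid)
open import Data.Bool using (Bool; true; false; T; not; _∧_; _∨_)
open import Data.Bool.ListAction using (any)
open import Data.Bool.Properties
  using (T?; T-≡; T-∧; T-not-≡; ∧-zeroʳ; ∧-identityʳ; ∨-comm; ∨-zeroʳ; ∨-identityʳ; ∧-commutativeMonoid)
open import Algebra.Properties.CommutativeSemigroup
  (CommutativeMonoid.commutativeSemigroup ∧-commutativeMonoid) using (xy∙z≈xz∙y; xy∙z≈zy∙x)
open import Data.Fin using (Fin; toℕ; zero; suc)
open import Data.Fin.Properties using (toℕ-injective; toℕ<n; pigeonhole; _≟_)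
import Data.Fin.Properties as Fin
open import Data.List using (List; []; _∷_; length; lookup; map; filterᵇ) renaming (allFin to allFinL)
open import Data.List.Properties using (length-filter; filter-notAll; length-tabulate; map-cong-local)
open import Data.List.Membership.Propositional using (_∈_; _∉_)
open import Data.List.Membership.Propositional.Properties
  using (∈-filter⁺; ∈-filter⁻; ∈-allFin; ∈-map⁺; ∈-map⁻)
open import Data.List.Relation.Binary.Subset.Propositional using (_⊆_)
open import Data.List.Relation.Unary.All as All using ()
open import Data.List.Relation.Unary.All.Properties using (all-filter)
open import Data.List.Relation.Unary.Any as Any using (index)
open import Data.List.Relation.Unary.Any.Properties using (any⁺; any⁻; lookup-index)
open import Data.Nat using (zero; _<_; _≡ᵇ_; _<ᵇ_; _≤ᵇ_; s≤s)
open import Data.Nat.Induction using (<-wellFounded)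
open import Data.Nat.Properties
  using (≡ᵇ⇒≡; ≡⇒≡ᵇ; ≮⇒≥; <⇒≱; <-irrefl; <-cmp; m≤n⇒m<n∨m≡n; +-suc; +-identityʳ; +-comm; *-suc;
         n<1+n; ≤-trans; ≤-reflexive; ≤-pred; <⇒<ᵇ)
open import Data.Product using (_,_; proj₁; proj₂; ∃)
open import Data.Sum using (inj₁; inj₂)
open import Function using (_∘_; id)
open import Function.Bundles using (_⇔_; mk⇔; Equivalence)
open import Function.Definitions using (Injective)
open import Induction.WellFounded using (Acc; acc)
open import Relation.Binary using (tri<; tri≈; tri>)
open import Relation.Binary.PropositionalEquality
  using (_≢_; _≗_; refl; sym; trans; cong; cong₂; subst; ≢-sym; module ≡-Reasoning)
open import Relation.Nullary using (¬_; yes; no; contradiction)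
open import Relation.Nullary.Reflects using (Reflects; ofʸ; ofⁿ; fromEquivalence)

open Equivalence using (to; from)
open ≡-Reasoning

private variable
  a b m n f : ℕ
  xs ys : List ℕ

∈⇒any-≡ᵇ : m ∈ xs → T (any (_≡ᵇ m) xs)
∈⇒any-≡ᵇ {m} = any⁺ (_≡ᵇ m) ∘ Any.map (λ { refl → ≡⇒≡ᵇ m m refl })

any-≡ᵇ⇒∈ : T (any (_≡ᵇ m) xs) → m ∈ xs
any-≡ᵇ⇒∈ {m} {xs} = Any.map (λ {x} p → sym (≡ᵇ⇒≡ x m p)) ∘ any⁻ (_≡ᵇ m) xs

below⊆⇒≤length : ∀ N → (∀ {j} → j < N → j ∈ xs) → N ≤ length xs
below⊆⇒≤length {xs} N below = ≮⇒≥ λ len<N →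
  let i , j , i<j , same-index = pigeonhole len<N (λ i → index (below (toℕ<n i)))
  in <-irrefl (same-lookup i j same-index) i<j
  where
  same-lookup : ∀ i j → index (below (toℕ<n i)) ≡ index (below (toℕ<n j)) → toℕ i ≡ toℕ j
  same-lookup i j same-index = trans (lookup-index (below (toℕ<n i)))
    (trans (cong (lookup xs) same-index) (sym (lookup-index (below (toℕ<n j)))))

below-suc : (∀ {j} → j < m → j ∈ xs) → m ∈ xs → ∀ {j} → j < suc m → j ∈ xs
below-suc below m∈xs (s≤s j≤m) with m≤n⇒m<n∨m≡n j≤m
... | inj₁ j<m  = below j<m
... | inj₂ refl = m∈xs

mexFrom-below : (∀ {j} → j < m → j ∈ xs) → ∀ f {j} → j < mexFrom xs f m → j ∈ xs
mexFrom-below below zero = below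
mexFrom-below {m} {xs} below (suc f) with any (_≡ᵇ m) xs in found
... | true  = mexFrom-below (below-suc below (any-≡ᵇ⇒∈ (subst T (sym found) _))) f
... | false = below

mexFrom-∉ : (∀ {j} → j < m → j ∈ xs) → ∀ f → length xs < f + m → mexFrom xs f m ∉ xs
mexFrom-∉ {m} below zero len<m = contradiction (below⊆⇒≤length m below) (<⇒≱ len<m)
mexFrom-∉ {m} {xs} below (suc f) len< with any (_≡ᵇ m) xs in found
... | true  = mexFrom-∉ (below-suc below (any-≡ᵇ⇒∈ (subst T (sym found) _))) f
                (subst (length xs <_) (sym (+-suc f m)) len<)
... | false = λ m∈xs → subst T found (∈⇒any-≡ᵇ m∈xs)

<mex⇒∈ : ∀ {j} → j < mex xs → j ∈ xs
<mex⇒∈ {xs} = mexFrom-below (λ ()) (suc (length xs))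

mex∉ : mex xs ∉ xs
mex∉ {xs} = mexFrom-∉ (λ ()) (suc (length xs)) (subst (length xs <_) (sym (+-identityʳ _)) (n<1+n _))

mex-⊆-≡ : ys ⊆ xs → mex ys ∉ xs → mex xs ≡ mex ys
mex-⊆-≡ {ys} {xs} ys⊆xs mex-ys∉xs with <-cmp (mex xs) (mex ys)
... | tri< lt _ _ = contradiction (ys⊆xs (<mex⇒∈ lt)) mex∉
... | tri≈ _ eq _ = eq
... | tri> _ _ gt = contradiction (<mex⇒∈ gt) mex-ys∉xs

VertexSet : ℕ → Set
VertexSet n = Fin n → Bool

-- A record, so that the vertex and the set can be inferred from a membership proof.
record _∈ᵛ_ (x : Fin n) (S : VertexSet n) : Set where
  constructor member
  field is-member : T (S x)
open _∈ᵛ_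

infix 4 _∈ᵛ_
infixl 7 _∩_
infixl 6 _─_

_∩_ : VertexSet n → VertexSet n → VertexSet n
(S ∩ A) x = S x ∧ A x

others : Fin n → VertexSet n
others u x = not (toℕ u ≡ᵇ toℕ x)

_─_ : VertexSet n → Fin n → VertexSet n
S ─ u = S ∩ others u

moves : VertexSet n → List (Fin n)
moves {n} S = filterᵇ S (allFinL n)

size : VertexSet n → ℕ
size S = length (moves S)

private variable
  S U A B : VertexSet n
  t u v w x y : Fin n

toℕ-≡ᵇ-reflects : (u x : Fin n) → Reflects (u ≡ x) (toℕ u ≡ᵇ toℕ x)
toℕ-≡ᵇ-reflects u x = fromEquivalence (toℕ-injective ∘ ≡ᵇ⇒≡ _ _) (≡⇒≡ᵇ _ _ ∘ cong toℕ)

others-self : (u : Fin n) → others u u ≡ false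
others-self u with toℕ u ≡ᵇ toℕ u | toℕ-≡ᵇ-reflects u u
... | true  | _       = refl
... | false | ofⁿ u≢u = contradiction refl u≢u

others-≢ : u ≢ x → others u x ≡ true
others-≢ {u = u} {x} u≢x with toℕ u ≡ᵇ toℕ x | toℕ-≡ᵇ-reflects u x
... | true  | ofʸ u≡x = contradiction u≡x u≢x
... | false | _       = refl

T-others : T (others u x) ⇔ u ≢ x
T-others {u = u} {x} with toℕ u ≡ᵇ toℕ x | toℕ-≡ᵇ-reflects u x
... | true  | ofʸ u≡x = mk⇔ (λ ()) (λ u≢x → u≢x u≡x)
... | false | ofⁿ u≢x = mk⇔ (λ _ → u≢x) _

∩-swap : (S A B : VertexSet n) → (S ∩ A) ∩ B ≗ (S ∩ B) ∩ A
∩-swap S A B x = xy∙z≈xz∙y (S x) (A x) (B x)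

∩-congˡ : (A : VertexSet n) → S ≗ U → S ∩ A ≗ U ∩ A
∩-congˡ A S≗U x = cong (_∧ A x) (S≗U x)

∩-cong-on : (S : VertexSet n) → (∀ {x} → x ∈ᵛ S → A x ≡ B x) → S ∩ A ≗ S ∩ B
∩-cong-on S A≡B x with S x in x∈S
... | false = refl
... | true  = A≡B (member (subst T (sym x∈S) _))

─-absorb : (S : VertexSet n) (u : Fin n) → S u ≡ false → S ─ u ≗ S
─-absorb S u u∉S x with toℕ u ≡ᵇ toℕ x | toℕ-≡ᵇ-reflects u x
... | true  | ofʸ refl = trans (∧-zeroʳ (S u)) (sym u∉S)
... | false | _        = ∧-identityʳ (S x)

─-comm : (S : VertexSet n) (u w : Fin n) → S ─ u ─ w ≗ S ─ w ─ u
─-comm S u w = ∩-swap S (others u) (others w)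

∈-─⁺ : x ∈ᵛ S → u ≢ x → x ∈ᵛ S ─ u
∈-─⁺ (member x∈S) u≢x = member (T-∧ .from (x∈S , T-others .from u≢x))

∈-─⁻ : (u : Fin n) → x ∈ᵛ S ─ u → x ∈ᵛ S × u ≢ x
∈-─⁻ {x = x} {S = S} u (member x∈) = let x∈S , ux = T-∧ {S x} .to x∈ in member x∈S , T-others .to ux

∈-─-─⁺ : x ∈ᵛ S → u ≢ x → w ≢ x → x ∈ᵛ S ─ u ─ w
∈-─-─⁺ x∈S u≢x w≢x = ∈-─⁺ (∈-─⁺ x∈S u≢x) w≢x

∈-─-─⁻ : (u w : Fin n) → x ∈ᵛ S ─ u ─ w → x ∈ᵛ S × u ≢ x × w ≢ x
∈-─-─⁻ u w x∈ = let x∈S─u , w≢x = ∈-─⁻ w x∈ ; x∈S , u≢x = ∈-─⁻ u x∈S─u in x∈S , u≢x , w≢x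

filterᵇ-∧ : ∀ {X : Set} (p q : X → Bool) xs → filterᵇ (λ x → p x ∧ q x) xs ≡ filterᵇ q (filterᵇ p xs)
filterᵇ-∧ p q [] = refl
filterᵇ-∧ p q (x ∷ xs) with p x
... | false = filterᵇ-∧ p q xs
... | true with q x
...   | false = filterᵇ-∧ p q xs
...   | true  = cong (x ∷_) (filterᵇ-∧ p q xs)

∈-moves⁺ : v ∈ᵛ S → v ∈ moves S
∈-moves⁺ {v = v} {S = S} (member v∈S) = ∈-filter⁺ (T? ∘ S) (∈-allFin v) v∈S

∈-moves⁻ : v ∈ moves S → v ∈ᵛ S
∈-moves⁻ {S = S} = member ∘ proj₂ ∘ ∈-filter⁻ (T? ∘ S) {xs = allFinL _}

size≤n : (S : VertexSet n) → size S ≤ n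
size≤n {n} S = ≤-trans (length-filter (T? ∘ S) (allFinL n)) (≤-reflexive (length-tabulate _))

size-∩< : v ∈ᵛ S → ¬ T (A v) → size (S ∩ A) < size S
size-∩< {S = S} {A = A} v∈S v∉A = subst (_< size S) (sym (cong length (filterᵇ-∧ S A (allFinL _))))
  (filter-notAll (T? ∘ A) (moves S) (Any.map (λ { refl → v∉A }) (∈-moves⁺ v∈S)))

-- Node-Kayles positions and their Grundy values

module _ (G : Graph n) where

  away : Fin n → VertexSet n
  away v x = others v x ∧ not (adj G v x)

  -- Definitionally equal to removeClosedNbhd G v S.
  play : Fin n → VertexSet n → VertexSet n
  play v S = S ∩ away v

  grundyOn : VertexSet n → ℕ
  grundyOn = grundyAux G n

  options : VertexSet n → List ℕ
  options S = map (λ v → grundyOn (play v S)) (moves S)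

  ∈-play⁺ : x ∈ᵛ S → v ≢ x → adj G v x ≡ false → x ∈ᵛ play v S
  ∈-play⁺ (member x∈S) v≢x vx = member (T-∧ .from (x∈S , T-∧ .from (T-others .from v≢x , T-not-≡ .from vx)))

  ∈-play⁻ : (v : Fin n) → x ∈ᵛ play v S → x ∈ᵛ S × adj G v x ≡ false
  ∈-play⁻ {x = x} {S = S} v (member x∈) =
    let x∈S , x∈away = T-∧ {S x} .to x∈ in member x∈S , T-not-≡ .to (proj₂ (T-∧ {others v x} .to x∈away))

  play-cong : (v : Fin n) → S ≗ U → play v S ≗ play v U
  play-cong v = ∩-congˡ (away v)

  play-─-─ : (v : Fin n) (S : VertexSet n) (u w : Fin n) → play v (S ─ u ─ w) ≗ play v S ─ u ─ w
  play-─-─ v S u w x =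
    trans (∩-swap (S ─ u) (others w) (away v) x) (∩-congˡ (others w) (∩-swap S (others u) (away v)) x)

  play-adjacent : (S : VertexSet n) → adj G v u ≡ true → play v S u ≡ false
  play-adjacent {v = v} {u = u} S vu rewrite vu =
    trans (cong (S u ∧_) (∧-zeroʳ (others v u))) (∧-zeroʳ (S u))

  play-─-adjacent : (S : VertexSet n) → adj G v u ≡ true → adj G v w ≡ true → play v (S ─ u ─ w) ≗ play v S
  play-─-adjacent {v = v} {u = u} {w = w} S vu vw x = trans (play-─-─ v S u w x)
    (trans (─-absorb (play v S ─ u) w (cong (_∧ others u w) (play-adjacent S vw)) x)
           (─-absorb (play v S) u (play-adjacent S vu) x))

  size-play< : v ∈ᵛ S → size (play v S) < size S
  size-play< {v = v} v∈S = size-∩< v∈S v∉away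
    where
    v∉away : ¬ T (away v v)
    v∉away rewrite others-self v = λ ()

  grundyAux-suc : (S : VertexSet n) → size S ≤ f → grundyAux G f S ≡ grundyAux G (suc f) S
  grundyAux-suc {f = zero} S size≤0 with moves S | size≤0
  ... | [] | _ = refl
  grundyAux-suc {f = suc f} S size≤1+f = cong mex (map-cong-local
    {f = λ v → grundyAux G f (play v S)} {g = λ v → grundyAux G (suc f) (play v S)}
    (All.map (λ v∈S → grundyAux-suc _ (≤-pred (≤-trans (size-play< (member v∈S)) size≤1+f)))
             (all-filter (T? ∘ S) (allFinL _))))

  grundyOn-unfold : (S : VertexSet n) → grundyOn S ≡ mex (options S)
  grundyOn-unfold S = grundyAux-suc S (size≤n S)

  ∈-options⁺ : v ∈ᵛ S → grundyOn (play v S) ∈ options S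
  ∈-options⁺ {S = S} v∈S = ∈-map⁺ (λ v → grundyOn (play v S)) (∈-moves⁺ v∈S)

  ∈-options⁻ : (S : VertexSet n) → ∀ {z} → z ∈ options S → ∃ λ v → v ∈ᵛ S × z ≡ grundyOn (play v S)
  ∈-options⁻ S z∈ with ∈-map⁻ (λ v → grundyOn (play v S)) z∈
  ... | v , v∈moves , refl = v , ∈-moves⁻ v∈moves , refl

  grundyOn-≢-option : v ∈ᵛ S → grundyOn (play v S) ≢ grundyOn S
  grundyOn-≢-option {S = S} v∈S eq =
    mex∉ {xs = options S} (subst (_∈ options S) (trans eq (grundyOn-unfold S)) (∈-options⁺ v∈S))

options-⊆ : (G : Graph a) (H : Graph b) →
            (∀ {v} → v ∈ᵛ S → grundyOn G (play G v S) ∈ options H U) → options G S ⊆ options H U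
options-⊆ {S = S} G H options∈ z∈ with ∈-options⁻ G S z∈
... | v , v∈S , refl = options∈ v∈S

module _ (G : Graph a) (H : Graph b) where

  grundyOn-⊆-≡ : (∀ {v} → v ∈ᵛ U → grundyOn H (play H v U) ∈ options G S) → grundyOn H U ∉ options G S →
                 grundyOn G S ≡ grundyOn H U
  grundyOn-⊆-≡ {U = U} {S = S} options∈ grundy∉ = begin
    grundyOn G S       ≡⟨ grundyOn-unfold G S ⟩
    mex (options G S)  ≡⟨ mex-⊆-≡ (options-⊆ H G options∈) (subst (_∉ options G S) (grundyOn-unfold H U) grundy∉) ⟩
    mex (options H U)  ≡⟨ grundyOn-unfold H U ⟨
    grundyOn H U       ∎

  grundyOn-≡ : (∀ {v} → v ∈ᵛ S → grundyOn G (play G v S) ∈ options H U) →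
               (∀ {v} → v ∈ᵛ U → grundyOn H (play H v U) ∈ options G S) →
               grundyOn G S ≡ grundyOn H U
  grundyOn-≡ {S = S} {U = U} options∈ options∋ = grundyOn-⊆-≡ options∋ λ grundy∈ →
    mex∉ {xs = options H U} (subst (_∈ options H U) (grundyOn-unfold H U) (options-⊆ G H options∈ grundy∈))

record Embedding (G : Graph a) (H : Graph b) : Set where
  field
    embed     : Fin a → Fin b
    injective : Injective _≡_ _≡_ embed
    adj-embed : ∀ x y → adj G x y ≡ adj H (embed x) (embed y)

module _ {G : Graph a} {H : Graph b} (e : Embedding G H) where
  open Embedding e

  others-embed : (u x : Fin a) → others (embed u) (embed x) ≡ others u x
  others-embed u x with toℕ u ≡ᵇ toℕ x | toℕ-≡ᵇ-reflects u x
  ... | true  | ofʸ refl = others-self (embed u)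
  ... | false | ofⁿ u≢x  = others-≢ (u≢x ∘ injective)

  play-embed : (v : Fin a) → (∀ x → S x ≡ U (embed x)) → ∀ x → play G v S x ≡ play H (embed v) U (embed x)
  play-embed v S≡U x = cong₂ _∧_ (S≡U x) (cong₂ _∧_ (sym (others-embed v x)) (cong not (adj-embed v x)))

  grundyOn-embed : (∀ x → S x ≡ U (embed x)) → (∀ {y} → y ∈ᵛ U → ∃ λ x → embed x ≡ y) →
                   grundyOn G S ≡ grundyOn H U
  grundyOn-embed = go (<-wellFounded _)
    where
    go : Acc _<_ (size S) → (∀ x → S x ≡ U (embed x)) → (∀ {y} → y ∈ᵛ U → ∃ λ x → embed x ≡ y) →
         grundyOn G S ≡ grundyOn H U
    go {S = S} {U = U} (acc rec) S≡U onto = grundyOn-≡ G H forth back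
      where
      embed-∈ᵛ : x ∈ᵛ S → embed x ∈ᵛ U
      embed-∈ᵛ {x} (member x∈S) = member (subst T (S≡U x) x∈S)
      step : v ∈ᵛ S → grundyOn G (play G v S) ≡ grundyOn H (play H (embed v) U)
      step {v} v∈S = go (rec (size-play< G v∈S)) (play-embed {U = U} v S≡U) (onto ∘ proj₁ ∘ ∈-play⁻ H (embed v))
      forth : v ∈ᵛ S → grundyOn G (play G v S) ∈ options H U
      forth v∈S = subst (_∈ options H U) (sym (step v∈S)) (∈-options⁺ H (embed-∈ᵛ v∈S))
      back : y ∈ᵛ U → grundyOn H (play H y U) ∈ options G S
      back y∈U with onto y∈U
      ... | x , refl = subst (_∈ options G S) (step x∈S) (∈-options⁺ G x∈S)
        where x∈S = member (subst T (sym (S≡U x)) (is-member y∈U))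

grundyOn-cong : (G : Graph n) → S ≗ U → grundyOn G S ≡ grundyOn G U
grundyOn-cong G S≗U = grundyOn-embed identity S≗U (λ {y} _ → y , refl)
  where
  identity : Embedding G G
  identity = record { embed = id ; injective = id ; adj-embed = λ _ _ → refl }

-- Isolated vertices and false twins

Symmetric : Graph n → Set
Symmetric G = ∀ x y → adj G x y ≡ adj G y x

Irreflexive : Graph n → Set
Irreflexive G = ∀ x → adj G x x ≡ false

module _ (G : Graph n) where

  Isolated : VertexSet n → Fin n → Set
  Isolated S u = ∀ {x} → x ∈ᵛ S → adj G u x ≡ false

  Twins : VertexSet n → Fin n → Fin n → Set
  Twins S u w = ∀ {x} → x ∈ᵛ S → adj G u x ≡ adj G w x

  play-isolated : Isolated S u → play G u S ≗ S ─ u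
  play-isolated {S = S} {u = u} u-iso = ∩-cong-on S λ {x} x∈S →
    trans (cong (λ b → others u x ∧ not b) (u-iso x∈S)) (∧-identityʳ _)

  play-twin-swap : Twins S u w → play G u S ─ w ≗ play G w S ─ u
  play-twin-swap {S = S} {u = u} {w = w} uw x with S x in x∈S
  ... | false = refl
  ... | true rewrite uw (member (subst T (sym x∈S) _)) = xy∙z≈zy∙x (others u x) (not (adj G w x)) (others w x)

  grundyOn-play-isolated-≢ : u ≢ w → w ∈ᵛ S → Isolated S u → Isolated S w →
                             grundyOn G (play G u S) ≢ grundyOn G (S ─ u ─ w)
  grundyOn-play-isolated-≢ {u = u} {w = w} {S = S} u≢w w∈S u-iso w-iso eq =
    grundyOn-≢-option G (∈-─⁺ w∈S u≢w) (begin
      grundyOn G (play G w (S ─ u))  ≡⟨ grundyOn-cong G (play-isolated w-iso′) ⟩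
      grundyOn G (S ─ u ─ w)         ≡⟨ eq ⟨
      grundyOn G (play G u S)        ≡⟨ grundyOn-cong G (play-isolated u-iso) ⟩
      grundyOn G (S ─ u)             ∎)
    where
    w-iso′ : Isolated (S ─ u) w
    w-iso′ = w-iso ∘ proj₁ ∘ ∈-─⁻ u

  module _ (symmetric : Symmetric G) (irreflexive : Irreflexive G) where

    grundyOn-─-isolated : u ≢ w → u ∈ᵛ S → w ∈ᵛ S → Isolated S u → Isolated S w →
                          grundyOn G (S ─ u ─ w) ≡ grundyOn G S
    grundyOn-─-isolated = go (<-wellFounded _)
      where
      go : Acc _<_ (size S) → u ≢ w → u ∈ᵛ S → w ∈ᵛ S → Isolated S u → Isolated S w →
           grundyOn G (S ─ u ─ w) ≡ grundyOn G S
      go {S = S} {u = u} {w = w} (acc rec) u≢w u∈S w∈S u-iso w-iso = sym (grundyOn-⊆-≡ G G option∈ grundy∉)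
        where
        survives : Isolated S x → x ∈ᵛ S → v ∈ᵛ S → v ≢ x → x ∈ᵛ play G v S
        survives x-iso x∈S v∈S v≢x = ∈-play⁺ G x∈S v≢x (trans (symmetric _ _) (x-iso v∈S))
        same : v ∈ᵛ S ─ u ─ w → grundyOn G (play G v (S ─ u ─ w)) ≡ grundyOn G (play G v S)
        same {v} v∈S′ = let v∈S , u≢v , w≢v = ∈-─-─⁻ u w v∈S′ in begin
          grundyOn G (play G v (S ─ u ─ w))  ≡⟨ grundyOn-cong G (play-─-─ G v S u w) ⟩
          grundyOn G (play G v S ─ u ─ w)    ≡⟨ go (rec (size-play< G v∈S)) u≢w
                                                  (survives u-iso u∈S v∈S (≢-sym u≢v)) (survives w-iso w∈S v∈S (≢-sym w≢v))
                                                  (u-iso ∘ proj₁ ∘ ∈-play⁻ G v) (w-iso ∘ proj₁ ∘ ∈-play⁻ G v) ⟩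
          grundyOn G (play G v S)            ∎
        option∈ : v ∈ᵛ S ─ u ─ w → grundyOn G (play G v (S ─ u ─ w)) ∈ options G S
        option∈ v∈S′ = subst (_∈ options G S) (sym (same v∈S′)) (∈-options⁺ G (proj₁ (∈-─-─⁻ u w v∈S′)))
        grundy∉ : grundyOn G (S ─ u ─ w) ∉ options G S
        grundy∉ g∈ with ∈-options⁻ G S g∈
        ... | v , v∈S , eq with v ≟ u | v ≟ w
        ... | yes refl | _        = grundyOn-play-isolated-≢ u≢w w∈S u-iso w-iso (sym eq)
        ... | no _     | yes refl =
          grundyOn-play-isolated-≢ (≢-sym u≢w) u∈S w-iso u-iso (trans (sym eq) (grundyOn-cong G (─-comm S u w)))
        ... | no v≢u   | no v≢w   =
          let v∈S′ = ∈-─-─⁺ v∈S (≢-sym v≢u) (≢-sym v≢w) in grundyOn-≢-option G v∈S′ (trans (same v∈S′) (sym eq))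

    ∈-play-twin : u ≢ w → w ∈ᵛ S → Twins S u w → w ∈ᵛ play G u S
    ∈-play-twin u≢w w∈S uw = ∈-play⁺ G w∈S u≢w (trans (uw w∈S) (irreflexive _))

    isolated-play-twin : Twins S u w → Isolated (play G u S) w
    isolated-play-twin {u = u} uw x∈ = let x∈S , ux = ∈-play⁻ G u x∈ in trans (sym (uw x∈S)) ux

    adj-twins : Twins S u w → v ∈ᵛ S → adj G v u ≡ adj G v w
    adj-twins {u = u} {w = w} {v = v} uw v∈S = trans (symmetric v u) (trans (uw v∈S) (symmetric w v))

    grundyOn-play-twin : u ≢ w → u ≢ t → w ≢ t → w ∈ᵛ S → t ∈ᵛ S → Twins S u w → Twins S u t →
                         grundyOn G (play G u S ─ w ─ t) ≡ grundyOn G (play G u S)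
    grundyOn-play-twin u≢w u≢t w≢t w∈S t∈S uw ut = grundyOn-─-isolated w≢t
      (∈-play-twin u≢w w∈S uw) (∈-play-twin u≢t t∈S ut) (isolated-play-twin uw) (isolated-play-twin ut)

    grundyOn-play-twin-exchange : u ≢ t → u ≢ w → t ≢ w → t ∈ᵛ S → w ∈ᵛ S → Twins S u t → Twins S u w →
                                  grundyOn G (play G t (S ─ u ─ w)) ≡ grundyOn G (play G u S)
    grundyOn-play-twin-exchange {u = u} {t = t} {w = w} {S = S} u≢t u≢w t≢w t∈S w∈S ut uw = begin
      grundyOn G (play G t (S ─ u ─ w))  ≡⟨ grundyOn-cong G (play-─-─ G t S u w) ⟩
      grundyOn G (play G t S ─ u ─ w)    ≡⟨ grundyOn-cong G (∩-congˡ (others w) (play-twin-swap (sym ∘ ut))) ⟩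
      grundyOn G (play G u S ─ t ─ w)    ≡⟨ grundyOn-play-twin u≢t u≢w t≢w t∈S w∈S ut uw ⟩
      grundyOn G (play G u S)            ∎

    grundyOn-─-twins : u ≢ w → u ≢ t → w ≢ t → u ∈ᵛ S → w ∈ᵛ S → t ∈ᵛ S → Twins S u w → Twins S u t →
                       grundyOn G (S ─ u ─ w) ≡ grundyOn G S
    grundyOn-─-twins = go (<-wellFounded _)
      where
      go : Acc _<_ (size S) → u ≢ w → u ≢ t → w ≢ t → u ∈ᵛ S → w ∈ᵛ S → t ∈ᵛ S → Twins S u w → Twins S u t →
           grundyOn G (S ─ u ─ w) ≡ grundyOn G S
      go {S = S} {u = u} {w = w} {t = t} (acc rec) u≢w u≢t w≢t u∈S w∈S t∈S uw ut = sym (grundyOn-≡ G G forth back)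
        where
        S′ : VertexSet n
        S′ = S ─ u ─ w
        t∈S′ : t ∈ᵛ S′
        t∈S′ = ∈-─-─⁺ t∈S u≢t w≢t
        wt : Twins S w t
        wt x∈S = trans (sym (uw x∈S)) (ut x∈S)
        same : v ∈ᵛ S′ → grundyOn G (play G v S′) ≡ grundyOn G (play G v S)
        same {v} v∈S′ with ∈-─-─⁻ u w v∈S′ | v ≟ t | adj G v u in vu
        ... | _ , _ , _         | yes refl | _     = begin
          grundyOn G (play G t S′)         ≡⟨ grundyOn-cong G (play-─-─ G t S u w) ⟩
          grundyOn G (play G t S ─ u ─ w)  ≡⟨ grundyOn-play-twin (≢-sym u≢t) (≢-sym w≢t) u≢w u∈S w∈S (sym ∘ ut) (sym ∘ wt) ⟩
          grundyOn G (play G t S)          ∎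
        ... | v∈S , _ , _       | no _     | true  =
          grundyOn-cong G (play-─-adjacent G S vu (trans (sym (adj-twins uw v∈S)) vu))
        ... | v∈S , u≢v , w≢v   | no v≢t   | false = begin
          grundyOn G (play G v S′)         ≡⟨ grundyOn-cong G (play-─-─ G v S u w) ⟩
          grundyOn G (play G v S ─ u ─ w)  ≡⟨ go (rec (size-play< G v∈S)) u≢w u≢t w≢t
                                                (∈-play⁺ G u∈S (≢-sym u≢v) vu)
                                                (∈-play⁺ G w∈S (≢-sym w≢v) (trans (sym (adj-twins uw v∈S)) vu))
                                                (∈-play⁺ G t∈S v≢t (trans (sym (adj-twins ut v∈S)) vu))
                                                (uw ∘ proj₁ ∘ ∈-play⁻ G v) (ut ∘ proj₁ ∘ ∈-play⁻ G v) ⟩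
          grundyOn G (play G v S)          ∎
        back : v ∈ᵛ S′ → grundyOn G (play G v S′) ∈ options G S
        back v∈S′ = subst (_∈ options G S) (sym (same v∈S′)) (∈-options⁺ G (proj₁ (∈-─-─⁻ u w v∈S′)))
        forth : v ∈ᵛ S → grundyOn G (play G v S) ∈ options G S′
        forth {v} v∈S with v ≟ u | v ≟ w
        ... | yes refl | _        = subst (_∈ options G S′)
          (grundyOn-play-twin-exchange u≢t u≢w (≢-sym w≢t) t∈S w∈S ut uw) (∈-options⁺ G t∈S′)
        ... | no _     | yes refl = subst (_∈ options G S′)
          (trans (grundyOn-cong G (play-cong G t (─-comm S u w)))
                 (grundyOn-play-twin-exchange w≢t (≢-sym u≢w) (≢-sym u≢t) t∈S u∈S wt (sym ∘ uw)))
          (∈-options⁺ G t∈S′)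
        ... | no v≢u   | no v≢w   = let v∈S′ = ∈-─-─⁺ v∈S (≢-sym v≢u) (≢-sym v≢w) in
          subst (_∈ options G S′) (same v∈S′) (∈-options⁺ G v∈S′)

-- Stars with a pendant path

≡ᵇ-comm : ∀ m n → (m ≡ᵇ n) ≡ (n ≡ᵇ m)
≡ᵇ-comm zero    zero    = refl
≡ᵇ-comm zero    (suc n) = refl
≡ᵇ-comm (suc m) zero    = refl
≡ᵇ-comm (suc m) (suc n) = ≡ᵇ-comm m n

fromEdges-symmetric : (n : ℕ) (e : ℕ → ℕ → Bool) → Symmetric (fromEdges n e)
fromEdges-symmetric n e x y =
  cong₂ (λ p q → not p ∧ q) (≡ᵇ-comm (toℕ x) (toℕ y)) (∨-comm (e (toℕ x) (toℕ y)) (e (toℕ y) (toℕ x)))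

fromEdges-irreflexive : (n : ℕ) (e : ℕ → ℕ → Bool) → Irreflexive (fromEdges n e)
fromEdges-irreflexive n e x = cong (_∧ (e (toℕ x) (toℕ x) ∨ e (toℕ x) (toℕ x))) (others-self x)

-- The edge predicate of starPath m k, which Defs declares locally to starPath.
starEdge : ℕ → ℕ → ℕ → ℕ → Bool
starEdge m k zero    b = (1 ≤ᵇ b) ∧ (b ≤ᵇ suc m)
starEdge m k (suc a) b = (m ≤ᵇ a) ∧ (suc a <ᵇ m + k) ∧ (b ≡ᵇ suc (suc a))

starPath-adj : (m k : ℕ) (x y : Fin (suc (m + k))) →
               adj (starPath m k) x y ≡ adj (fromEdges (suc (m + k)) (starEdge m k)) x y
starPath-adj m k zero    zero    = refl
starPath-adj m k zero    (suc y) = refl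
starPath-adj m k (suc x) zero    = refl
starPath-adj m k (suc x) (suc y) = refl

starPath-symmetric : (m k : ℕ) → Symmetric (starPath m k)
starPath-symmetric m k x y =
  trans (starPath-adj m k x y) (trans (fromEdges-symmetric _ (starEdge m k) x y) (sym (starPath-adj m k y x)))

starPath-irreflexive : (m k : ℕ) → Irreflexive (starPath m k)
starPath-irreflexive m k x = trans (starPath-adj m k x x) (fromEdges-irreflexive _ (starEdge m k) x)

module _ (m k : ℕ) where

  private
    G : Graph (suc (3 + m + k))
    G = starPath (3 + m) k

    full : VertexSet (suc (3 + m + k))
    full _ = true

    ℓ₁ ℓ₂ ℓ₃ : Fin (suc (3 + m + k))
    ℓ₁ = suc zero
    ℓ₂ = suc (suc zero)
    ℓ₃ = suc (suc (suc zero))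

  leaves-twins : (x : Fin (suc (3 + m + k))) → (adj G ℓ₁ x ≡ adj G ℓ₂ x) × (adj G ℓ₁ x ≡ adj G ℓ₃ x)
  leaves-twins zero                      = refl , refl
  leaves-twins (suc zero)                = refl , refl
  leaves-twins (suc (suc zero))          = refl , refl
  leaves-twins (suc (suc (suc zero)))    = refl , refl
  leaves-twins (suc (suc (suc (suc x)))) = refl , refl

  drop-two-leaves : Embedding (starPath (suc m) k) G
  drop-two-leaves = record { embed = embed ; injective = injective ; adj-embed = adj-embed }
    where
    embed : Fin (suc (suc m + k)) → Fin (suc (3 + m + k))
    embed zero    = zero
    embed (suc x) = suc (suc (suc x))
    injective : Injective _≡_ _≡_ embed
    injective {zero}  {zero}  _  = refl
    injective {suc x} {suc y} eq = cong suc (Fin.suc-injective (Fin.suc-injective (Fin.suc-injective eq)))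
    adj-embed : ∀ x y → adj (starPath (suc m) k) x y ≡ adj G (embed x) (embed y)
    adj-embed zero    zero    = refl
    adj-embed zero    (suc y) = refl
    adj-embed (suc x) zero    = refl
    adj-embed (suc x) (suc y) = refl

  grundy-starPath-+2 : grundy (starPath (3 + m) k) ≡ grundy (starPath (suc m) k)
  grundy-starPath-+2 = begin
    grundyOn G full               ≡⟨ grundyOn-─-twins G (starPath-symmetric _ k) (starPath-irreflexive _ k)
                                       {u = ℓ₁} {w = ℓ₂} {t = ℓ₃} {S = full} (λ ()) (λ ()) (λ ()) (member _) (member _) (member _)
                                       (λ {x} _ → proj₁ (leaves-twins x)) (λ {x} _ → proj₂ (leaves-twins x)) ⟨
    grundyOn G (full ─ ℓ₁ ─ ℓ₂)   ≡⟨ grundyOn-embed drop-two-leaves full≡ onto ⟨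
    grundy (starPath (suc m) k)   ∎
    where
    full≡ : ∀ x → true ≡ (full ─ ℓ₁ ─ ℓ₂) (Embedding.embed drop-two-leaves x)
    full≡ zero    = refl
    full≡ (suc x) = refl
    onto : ∀ {y} → y ∈ᵛ full ─ ℓ₁ ─ ℓ₂ → ∃ λ x → Embedding.embed drop-two-leaves x ≡ y
    onto {zero}              _ = zero , refl
    onto {suc (suc (suc y))} _ = suc y , refl

-- The range check in the pendant-path edges of starPath is implied by the vertex bound.
<ᵇ-∧-≡ᵇ-suc : ∀ {k} a b → b < k → ((suc a <ᵇ k) ∧ (b ≡ᵇ suc a)) ≡ (b ≡ᵇ suc a)
<ᵇ-∧-≡ᵇ-suc {k} a b b<k with b ≡ᵇ suc a in b≡1+a
... | false = ∧-zeroʳ (suc a <ᵇ k)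
... | true  = trans (∧-identityʳ _) (T-≡ .to (<⇒<ᵇ (subst (_< k) (≡ᵇ⇒≡ b (suc a) (subst T (sym b≡1+a) _)) b<k)))

module _ (k : ℕ) where

  swap01 : Fin (2 + k) → Fin (2 + k)
  swap01 zero          = suc zero
  swap01 (suc zero)    = zero
  swap01 (suc (suc x)) = suc (suc x)

  swap01-involutive : ∀ x → swap01 (swap01 x) ≡ x
  swap01-involutive zero          = refl
  swap01-involutive (suc zero)    = refl
  swap01-involutive (suc (suc x)) = refl

  star₁-path : Embedding (starPath 1 k) (pathGraph (2 + k))
  star₁-path = record { embed = swap01 ; injective = injective ; adj-embed = adj-embed }
    where
    injective : Injective _≡_ _≡_ swap01
    injective {x} {y} eq = trans (sym (swap01-involutive x)) (trans (cong swap01 eq) (swap01-involutive y))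
    adj-embed : ∀ x y → adj (starPath 1 k) x y ≡ adj (pathGraph (2 + k)) (swap01 x) (swap01 y)
    adj-embed zero                zero                = refl
    adj-embed zero                (suc zero)          = refl
    adj-embed zero                (suc (suc zero))    = refl
    adj-embed zero                (suc (suc (suc y))) = ∧-zeroʳ _
    adj-embed (suc zero)          zero                = refl
    adj-embed (suc zero)          (suc zero)          = refl
    adj-embed (suc zero)          (suc (suc y))       = ∧-zeroʳ _
    adj-embed (suc (suc zero))    zero                = ∨-zeroʳ _
    adj-embed (suc (suc (suc x))) zero                = trans (∨-identityʳ _) (∧-zeroʳ _)
    adj-embed (suc (suc x))       (suc zero)          = trans (∨-identityʳ _) (∧-zeroʳ _)
    adj-embed (suc (suc x))       (suc (suc y))
      rewrite <ᵇ-∧-≡ᵇ-suc (toℕ x) (toℕ y) (toℕ<n y) | <ᵇ-∧-≡ᵇ-suc (toℕ y) (toℕ x) (toℕ<n x) = refl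

  grundy-star₁ : grundy (starPath 1 k) ≡ grundy (pathGraph (2 + k))
  grundy-star₁ = grundyOn-embed star₁-path {S = λ _ → true} {U = λ _ → true}
    (λ _ → refl) (λ {y} _ → swap01 y , swap01-involutive y)

grundy-starPath-+2* : ∀ {m} k j → grundy (starPath (2 * j + suc m) k) ≡ grundy (starPath (suc m) k)
grundy-starPath-+2* k zero = refl
grundy-starPath-+2* {m} k (suc j) = begin
  grundy (starPath (2 * suc j + suc m) k)  ≡⟨ cong (λ l → grundy (starPath l k)) index≡ ⟩
  grundy (starPath (3 + (2 * j + m)) k)    ≡⟨ grundy-starPath-+2 (2 * j + m) k ⟩
  grundy (starPath (suc (2 * j + m)) k)    ≡⟨ cong (λ l → grundy (starPath l k)) (+-suc (2 * j) m) ⟨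
  grundy (starPath (2 * j + suc m) k)      ≡⟨ grundy-starPath-+2* k j ⟩
  grundy (starPath (suc m) k)              ∎
  where
  index≡ : 2 * suc j + suc m ≡ 3 + (2 * j + m)
  index≡ = trans (cong (_+ suc m) (*-suc 2 j)) (cong (λ l → 2 + l) (+-suc (2 * j) m))

mainTheorem5 : (n k : ℕ) → 1 ≤ n → 1 ≤ k →
    ((grundy (starPath (2 * n ∸ 1) k) ≡ grundy (starPath 1 k))
      × (grundy (starPath 1 k) ≡ grundy (pathGraph (k + 2))))
    × (grundy (starPath (2 * n) k) ≡ grundy (starPath 2 k))
mainTheorem5 (suc n) k _ _ = (odd , star₁≡path) , even
  where
  odd : grundy (starPath (2 * suc n ∸ 1) k) ≡ grundy (starPath 1 k)
  odd = trans (cong (λ l → grundy (starPath l k)) (trans (cong (_∸ 1) (*-suc 2 n)) (+-comm 1 (2 * n))))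
              (grundy-starPath-+2* k n)
  star₁≡path : grundy (starPath 1 k) ≡ grundy (pathGraph (k + 2))
  star₁≡path = trans (grundy-star₁ k) (cong (λ j → grundy (pathGraph j)) (+-comm 2 k))
  even : grundy (starPath (2 * suc n) k) ≡ grundy (starPath 2 k)
  even = trans (cong (λ l → grundy (starPath l k)) (trans (*-suc 2 n) (+-comm 2 (2 * n))))
               (grundy-starPath-+2* k n)
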